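{- Let $k\ge 2$. For every integer $N\ge 0$ there exist a graph $G'$, a closed neighborhood balanced $k$-coloring $c'$ of $G'$ and a color $i\in\{1,\dots,k\}$ such that $|c'^{ -1}(j)|\ge |c'^{ -1}(i)|+N$ for every color $j\ne i$. Moreover, for every graph $G$ admitting a closed neighborhood balanced $k$-coloring and every integer $N\ge 0$, such a graph $G'$ (with such $c'$ and $i$) can be chosen to contain $G$ as an induced subgraph.
   Context: All graphs are finite and simple; $N[v]$ is the closed neighborhood of $v$. A closed neighborhood balanced $k$-coloring of a graph $G$ is a map $c:V(G)\to\{1,\dots,k\}$ such that for every vertex $v$ the numbers $|N[v]\cap c^{ -1}(i)|$, $i=1,\dots,k$, are all equal. -}

module Defs where

open import Data.Nat using (ℕ; zero; suc; _+_; _≤_)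
open import Data.Fin using (Fin; _≟_)
open import Data.Bool using (Bool; true; false; _∨_; _∧_; if_then_else_)
open import Data.List using (List; length; filter)
open import Data.List using () renaming (map to lmap)
open import Data.Fin.Base using ()
open import Data.List.Base using ()
open import Data.Product using (Σ; _×_; ∃; _,_)
open import Relation.Binary.PropositionalEquality using (_≡_; _≢_)
open import Relation.Nullary.Decidable using (⌊_⌋)
open import Function.Definitions using (Injective)
open import Data.Fin.Base using () renaming (toℕ to toℕ)
import Data.List.Base as L
import Data.Bool as B

record Graph : Set where
  field
    n     : ℕ
    adj   : Fin n → Fin n → Bool
    irrefl : ∀ v → adj v v ≡ false
    sym   : ∀ u v → adj u v ≡ adj v u
open Graph public

vertices : (n : ℕ) → List (Fin n)
vertices n = L.allFin n

inClosedNbhd : (G : Graph) → Fin (n G) → Fin (n G) → Bool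
inClosedNbhd G v u = ⌊ u ≟ v ⌋ ∨ adj G v u

nbhdColorCount : (G : Graph) {k : ℕ} → (Fin (n G) → Fin k) → Fin (n G) → Fin k → ℕ
nbhdColorCount G c v i =
  length (filter (λ u → (inClosedNbhd G v u ∧ ⌊ c u ≟ i ⌋) B.≟ true) (vertices (n G)))

colorClassSize : (G : Graph) {k : ℕ} → (Fin (n G) → Fin k) → Fin k → ℕ
colorClassSize G c i = length (filter (λ u → c u ≟ i) (vertices (n G)))

IsCNBColoring : (G : Graph) (k : ℕ) → (Fin (n G) → Fin k) → Set
IsCNBColoring G k c = ∀ v i j → nbhdColorCount G c v i ≡ nbhdColorCount G c v j

HasCNBColoring : (G : Graph) (k : ℕ) → Set
HasCNBColoring G k = Σ (Fin (n G) → Fin k) (IsCNBColoring G k)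

IsInducedSubgraphOf : Graph → Graph → Set
IsInducedSubgraphOf G H =
  Σ (Fin (n G) → Fin (n H)) λ f →
    Injective _≡_ _≡_ f × (∀ u v → adj H (f u) (f v) ≡ adj G u v)

Unbalanced : (k N : ℕ) → Graph → Set
Unbalanced k N G' =
  Σ (Fin (n G') → Fin k) λ c' → IsCNBColoring G' k c' ×
    Σ (Fin k) λ i → ∀ j → j ≢ i → colorClassSize G' c' i + N ≤ colorClassSize G' c' j

{-# OPTIONS --safe #-}
-- Disjoint unions keep closed neighbourhood balanced colourings balanced and add colour classes,
-- so one balanced gadget in which colour 0 is strictly rarer than every other colour suffices:
-- N + |G| copies of it beside G leave colour 0 at least N behind.  The gadget is two windmills
-- (two rainbow cliques K_{m+1} sharing their colour-0 centre) with the centres joined: each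
-- centre then sees two vertices of every colour and each other vertex one, while colour 0 has
-- 2 vertices and every other colour 4.
module Submission where

open import Defs
open import Data.Nat using (ℕ; zero; suc; _+_; _*_; _≤_)
open import Data.Nat.Properties
  using (+-assoc; +-identityʳ; n≤1+n; m≤n+m; +-monoˡ-≤; *-monoʳ-≤; module ≤-Reasoning)
open import Data.Fin using (Fin; zero; suc; _≟_; _↑ˡ_; _↑ʳ_; splitAt)
import Data.Fin as Fin
open import Data.Fin.Properties using (↑ˡ-injective; ↑ʳ-injective; splitAt-↑ˡ; splitAt-↑ʳ; join-splitAt; suc-injective)
open import Data.Vec.Functional using (_++_)
open import Data.Vec.Functional.Properties using (lookup-++ˡ; lookup-++ʳ)
open import Data.Bool using (Bool; true; false; _∨_; _∧_; not; if_then_else_)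
import Data.Bool as B
open import Data.Bool.Properties using (∨-inverseʳ)
open import Data.List using (length; filter; tabulate; allFin)
open import Data.List.Properties using (length-tabulate; length-filter)
open import Data.Nat.Solver using (module +-*-Solver)
open import Data.Sum using (_⊎_; inj₁; inj₂)
open import Data.Product using (Σ; _×_; _,_)
open import Data.Empty using (⊥-elim)
open import Relation.Nullary using (Dec; yes; no; ¬_)
open import Relation.Nullary.Decidable using (⌊_⌋)
open import Relation.Unary using (Decidable)
open import Relation.Binary.PropositionalEquality
  using (_≡_; refl; trans; cong; cong₂; subst; _≢_; _≗_; module ≡-Reasoning)
  renaming (sym to ≡-sym)
open import Function using (_∘_; id)

count : ∀ {n} → (Fin n → Bool) → ℕ
count {zero}  p = 0
count {suc n} p = (if p zero then 1 else 0) + count (p ∘ suc)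

count-cong : ∀ {n} {p q : Fin n → Bool} → p ≗ q → count p ≡ count q
count-cong {zero}  p≗q = refl
count-cong {suc n} p≗q = cong₂ (λ b m → (if b then 1 else 0) + m) (p≗q zero) (count-cong (p≗q ∘ suc))

count-false : ∀ n → count {n} (λ _ → false) ≡ 0
count-false zero    = refl
count-false (suc n) = count-false n

count-↑ : ∀ a b (p : Fin (a + b) → Bool) → count p ≡ count (p ∘ (_↑ˡ b)) + count (p ∘ (a ↑ʳ_))
count-↑ zero    b p = refl
count-↑ (suc a) b p =
  trans (cong (δ +_) (count-↑ a b (p ∘ suc)))
        (≡-sym (+-assoc δ (count (p ∘ suc ∘ (_↑ˡ b))) (count (p ∘ suc ∘ (a ↑ʳ_)))))
  where
  δ = if p zero then 1 else 0

⌊⌋-⇔ : ∀ {P Q : Set} (p : Dec P) (q : Dec Q) → (P → Q) → (Q → P) → ⌊ p ⌋ ≡ ⌊ q ⌋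
⌊⌋-⇔ (yes _) (yes _) P→Q Q→P = refl
⌊⌋-⇔ (yes p) (no ¬q) P→Q Q→P = ⊥-elim (¬q (P→Q p))
⌊⌋-⇔ (no ¬p) (yes q) P→Q Q→P = ⊥-elim (¬p (Q→P q))
⌊⌋-⇔ (no _)  (no _)  P→Q Q→P = refl

⌊⌋-true : ∀ {P : Set} (p : Dec P) → P → ⌊ p ⌋ ≡ true
⌊⌋-true (yes _) p = refl
⌊⌋-true (no ¬p) p = ⊥-elim (¬p p)

⌊⌋-false : ∀ {P : Set} (p : Dec P) → ¬ P → ⌊ p ⌋ ≡ false
⌊⌋-false (yes p) ¬p = ⊥-elim (¬p p)
⌊⌋-false (no _)  ¬p = refl

count-singleton : ∀ {n} (j : Fin n) → count (λ u → ⌊ u ≟ j ⌋) ≡ 1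
count-singleton {suc n} zero = cong suc (count-false n)
count-singleton (suc j)      =
  trans (count-cong (λ u → ⌊⌋-⇔ (suc u ≟ suc j) (u ≟ j) suc-injective (cong suc))) (count-singleton j)

length-filter-tabulate : ∀ {A : Set} {P : A → Set} (P? : Decidable P) {n} (f : Fin n → A) →
  length (filter P? (tabulate f)) ≡ count (λ u → ⌊ P? (f u) ⌋)
length-filter-tabulate P? {zero}  f = refl
length-filter-tabulate P? {suc n} f with P? (f zero)
... | yes _ = cong suc (length-filter-tabulate P? (f ∘ suc))
... | no _  = length-filter-tabulate P? (f ∘ suc)

nbhdColorCount≡count : ∀ (G : Graph) {k} (c : Fin (n G) → Fin k) v i →
  nbhdColorCount G c v i ≡ count (λ u → inClosedNbhd G v u ∧ ⌊ c u ≟ i ⌋)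
nbhdColorCount≡count G c v i =
  trans (length-filter-tabulate (λ u → (inClosedNbhd G v u ∧ ⌊ c u ≟ i ⌋) B.≟ true) id)
        (count-cong (λ u → ⌊≟true⌋ (inClosedNbhd G v u ∧ ⌊ c u ≟ i ⌋)))
  where
  ⌊≟true⌋ : ∀ b → ⌊ b B.≟ true ⌋ ≡ b
  ⌊≟true⌋ true  = refl
  ⌊≟true⌋ false = refl

colorClassSize≡count : ∀ (G : Graph) {k} (c : Fin (n G) → Fin k) i →
  colorClassSize G c i ≡ count (λ u → ⌊ c u ≟ i ⌋)
colorClassSize≡count G c i = length-filter-tabulate (λ u → c u ≟ i) id

colorClassSize≤n : ∀ (G : Graph) {k} (c : Fin (n G) → Fin k) i → colorClassSize G c i ≤ n G
colorClassSize≤n G c i =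
  subst (colorClassSize G c i ≤_) (length-tabulate id) (length-filter (λ u → c u ≟ i) (allFin (n G)))

↑-cases : ∀ {a b} (P : Fin (a + b) → Set) → (∀ x → P (x ↑ˡ b)) → (∀ y → P (a ↑ʳ y)) → ∀ u → P u
↑-cases {a} {b} P left right u = subst P (join-splitAt a b u) (by-side (splitAt a u))
  where
  by-side : ∀ s → P (Fin.join a b s)
  by-side (inj₁ x) = left x
  by-side (inj₂ y) = right y

↑ʳ≢↑ˡ : ∀ {a b} (x : Fin a) (y : Fin b) → a ↑ʳ y ≢ x ↑ˡ b
↑ʳ≢↑ˡ {a} {b} x y eq
  with () ← trans (≡-sym (splitAt-↑ʳ a b y)) (trans (cong (splitAt a) eq) (splitAt-↑ˡ a x b))

module _ (G₁ G₂ : Graph) where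

  blockAdj : (Fin (n G₁) → Fin (n G₂) → Bool) → Fin (n G₁) ⊎ Fin (n G₂) → Fin (n G₁) ⊎ Fin (n G₂) → Bool
  blockAdj X (inj₁ a) (inj₁ b) = adj G₁ a b
  blockAdj X (inj₁ a) (inj₂ b) = X a b
  blockAdj X (inj₂ a) (inj₁ b) = X b a
  blockAdj X (inj₂ a) (inj₂ b) = adj G₂ a b

  connect : (Fin (n G₁) → Fin (n G₂) → Bool) → Graph
  connect X = record
    { n      = n G₁ + n G₂
    ; adj    = λ u v → blockAdj X (splitAt (n G₁) u) (splitAt (n G₁) v)
    ; irrefl = λ u → blockAdj-irrefl (splitAt (n G₁) u)
    ; sym    = λ u v → blockAdj-sym (splitAt (n G₁) u) (splitAt (n G₁) v)
    }
    where
    blockAdj-irrefl : ∀ s → blockAdj X s s ≡ false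
    blockAdj-irrefl (inj₁ a) = irrefl G₁ a
    blockAdj-irrefl (inj₂ b) = irrefl G₂ b
    blockAdj-sym : ∀ s t → blockAdj X s t ≡ blockAdj X t s
    blockAdj-sym (inj₁ a) (inj₁ b) = sym G₁ a b
    blockAdj-sym (inj₁ a) (inj₂ b) = refl
    blockAdj-sym (inj₂ a) (inj₁ b) = refl
    blockAdj-sym (inj₂ a) (inj₂ b) = sym G₂ a b

  disjointUnion : Graph
  disjointUnion = connect (λ _ _ → false)

  join : Graph
  join = connect (λ _ _ → true)

module _ (G₁ G₂ : Graph) (X : Fin (n G₁) → Fin (n G₂) → Bool) where

  private
    S = connect G₁ G₂ X

  adj-↑ˡ-↑ˡ : ∀ a b → adj S (a ↑ˡ n G₂) (b ↑ˡ n G₂) ≡ adj G₁ a b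
  adj-↑ˡ-↑ˡ a b rewrite splitAt-↑ˡ (n G₁) a (n G₂) | splitAt-↑ˡ (n G₁) b (n G₂) = refl

  adj-↑ˡ-↑ʳ : ∀ a b → adj S (a ↑ˡ n G₂) (n G₁ ↑ʳ b) ≡ X a b
  adj-↑ˡ-↑ʳ a b rewrite splitAt-↑ˡ (n G₁) a (n G₂) | splitAt-↑ʳ (n G₁) (n G₂) b = refl

  adj-↑ʳ-↑ˡ : ∀ b a → adj S (n G₁ ↑ʳ b) (a ↑ˡ n G₂) ≡ X a b
  adj-↑ʳ-↑ˡ b a rewrite splitAt-↑ˡ (n G₁) a (n G₂) | splitAt-↑ʳ (n G₁) (n G₂) b = refl

  adj-↑ʳ-↑ʳ : ∀ a b → adj S (n G₁ ↑ʳ a) (n G₁ ↑ʳ b) ≡ adj G₂ a b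
  adj-↑ʳ-↑ʳ a b rewrite splitAt-↑ʳ (n G₁) (n G₂) a | splitAt-↑ʳ (n G₁) (n G₂) b = refl

  connect-induced : IsInducedSubgraphOf G₁ S
  connect-induced = (_↑ˡ n G₂) , (λ {a} {b} → ↑ˡ-injective (n G₂) a b) , adj-↑ˡ-↑ˡ

  module _ {k} (c₁ : Fin (n G₁) → Fin k) (c₂ : Fin (n G₂) → Fin k) where

    colorClassSize-connect : ∀ i →
      colorClassSize S (c₁ ++ c₂) i ≡ colorClassSize G₁ c₁ i + colorClassSize G₂ c₂ i
    colorClassSize-connect i = begin
      colorClassSize S (c₁ ++ c₂) i
        ≡⟨ colorClassSize≡count S (c₁ ++ c₂) i ⟩
      count (λ u → ⌊ (c₁ ++ c₂) u ≟ i ⌋)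
        ≡⟨ count-↑ (n G₁) (n G₂) _ ⟩
      count (λ a → ⌊ (c₁ ++ c₂) (a ↑ˡ n G₂) ≟ i ⌋) + count (λ b → ⌊ (c₁ ++ c₂) (n G₁ ↑ʳ b) ≟ i ⌋)
        ≡⟨ cong₂ _+_ (count-cong (λ a → cong (λ x → ⌊ x ≟ i ⌋) (lookup-++ˡ c₁ c₂ a)))
                     (count-cong (λ b → cong (λ x → ⌊ x ≟ i ⌋) (lookup-++ʳ c₁ c₂ b))) ⟩
      count (λ a → ⌊ c₁ a ≟ i ⌋) + count (λ b → ⌊ c₂ b ≟ i ⌋)
        ≡⟨ ≡-sym (cong₂ _+_ (colorClassSize≡count G₁ c₁ i) (colorClassSize≡count G₂ c₂ i)) ⟩
      colorClassSize G₁ c₁ i + colorClassSize G₂ c₂ i ∎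
      where open ≡-Reasoning

    nbhdColorCount-↑ˡ : ∀ a i → nbhdColorCount S (c₁ ++ c₂) (a ↑ˡ n G₂) i
                              ≡ nbhdColorCount G₁ c₁ a i + count (λ b → X a b ∧ ⌊ c₂ b ≟ i ⌋)
    nbhdColorCount-↑ˡ a i = begin
      nbhdColorCount S (c₁ ++ c₂) (a ↑ˡ n G₂) i
        ≡⟨ nbhdColorCount≡count S (c₁ ++ c₂) (a ↑ˡ n G₂) i ⟩
      count (λ u → inClosedNbhd S (a ↑ˡ n G₂) u ∧ ⌊ (c₁ ++ c₂) u ≟ i ⌋)
        ≡⟨ count-↑ (n G₁) (n G₂) _ ⟩
      count (λ u → inClosedNbhd S (a ↑ˡ n G₂) (u ↑ˡ n G₂) ∧ ⌊ (c₁ ++ c₂) (u ↑ˡ n G₂) ≟ i ⌋)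
        + count (λ b → inClosedNbhd S (a ↑ˡ n G₂) (n G₁ ↑ʳ b) ∧ ⌊ (c₁ ++ c₂) (n G₁ ↑ʳ b) ≟ i ⌋)
        ≡⟨ cong₂ _+_ (count-cong inside) (count-cong across) ⟩
      count (λ u → inClosedNbhd G₁ a u ∧ ⌊ c₁ u ≟ i ⌋) + count (λ b → X a b ∧ ⌊ c₂ b ≟ i ⌋)
        ≡⟨ cong (_+ _) (≡-sym (nbhdColorCount≡count G₁ c₁ a i)) ⟩
      nbhdColorCount G₁ c₁ a i + count (λ b → X a b ∧ ⌊ c₂ b ≟ i ⌋) ∎
      where
      open ≡-Reasoning
      inside : ∀ u → inClosedNbhd S (a ↑ˡ n G₂) (u ↑ˡ n G₂) ∧ ⌊ (c₁ ++ c₂) (u ↑ˡ n G₂) ≟ i ⌋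
                   ≡ inClosedNbhd G₁ a u ∧ ⌊ c₁ u ≟ i ⌋
      inside u = cong₂ _∧_
        (cong₂ _∨_ (⌊⌋-⇔ (u ↑ˡ n G₂ ≟ a ↑ˡ n G₂) (u ≟ a) (↑ˡ-injective (n G₂) u a) (cong (_↑ˡ n G₂)))
                   (adj-↑ˡ-↑ˡ a u))
        (cong (λ x → ⌊ x ≟ i ⌋) (lookup-++ˡ c₁ c₂ u))
      across : ∀ b → inClosedNbhd S (a ↑ˡ n G₂) (n G₁ ↑ʳ b) ∧ ⌊ (c₁ ++ c₂) (n G₁ ↑ʳ b) ≟ i ⌋
                   ≡ X a b ∧ ⌊ c₂ b ≟ i ⌋
      across b = cong₂ _∧_
        (cong₂ _∨_ (⌊⌋-false (n G₁ ↑ʳ b ≟ a ↑ˡ n G₂) (↑ʳ≢↑ˡ a b)) (adj-↑ˡ-↑ʳ a b))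
        (cong (λ x → ⌊ x ≟ i ⌋) (lookup-++ʳ c₁ c₂ b))

    nbhdColorCount-↑ʳ : ∀ b i → nbhdColorCount S (c₁ ++ c₂) (n G₁ ↑ʳ b) i
                              ≡ count (λ a → X a b ∧ ⌊ c₁ a ≟ i ⌋) + nbhdColorCount G₂ c₂ b i
    nbhdColorCount-↑ʳ b i = begin
      nbhdColorCount S (c₁ ++ c₂) (n G₁ ↑ʳ b) i
        ≡⟨ nbhdColorCount≡count S (c₁ ++ c₂) (n G₁ ↑ʳ b) i ⟩
      count (λ u → inClosedNbhd S (n G₁ ↑ʳ b) u ∧ ⌊ (c₁ ++ c₂) u ≟ i ⌋)
        ≡⟨ count-↑ (n G₁) (n G₂) _ ⟩
      count (λ a → inClosedNbhd S (n G₁ ↑ʳ b) (a ↑ˡ n G₂) ∧ ⌊ (c₁ ++ c₂) (a ↑ˡ n G₂) ≟ i ⌋)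
        + count (λ u → inClosedNbhd S (n G₁ ↑ʳ b) (n G₁ ↑ʳ u) ∧ ⌊ (c₁ ++ c₂) (n G₁ ↑ʳ u) ≟ i ⌋)
        ≡⟨ cong₂ _+_ (count-cong across) (count-cong inside) ⟩
      count (λ a → X a b ∧ ⌊ c₁ a ≟ i ⌋) + count (λ u → inClosedNbhd G₂ b u ∧ ⌊ c₂ u ≟ i ⌋)
        ≡⟨ cong (_ +_) (≡-sym (nbhdColorCount≡count G₂ c₂ b i)) ⟩
      count (λ a → X a b ∧ ⌊ c₁ a ≟ i ⌋) + nbhdColorCount G₂ c₂ b i ∎
      where
      open ≡-Reasoning
      across : ∀ a → inClosedNbhd S (n G₁ ↑ʳ b) (a ↑ˡ n G₂) ∧ ⌊ (c₁ ++ c₂) (a ↑ˡ n G₂) ≟ i ⌋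
                   ≡ X a b ∧ ⌊ c₁ a ≟ i ⌋
      across a = cong₂ _∧_
        (cong₂ _∨_ (⌊⌋-false (a ↑ˡ n G₂ ≟ n G₁ ↑ʳ b) (↑ʳ≢↑ˡ a b ∘ ≡-sym)) (adj-↑ʳ-↑ˡ b a))
        (cong (λ x → ⌊ x ≟ i ⌋) (lookup-++ˡ c₁ c₂ a))
      inside : ∀ u → inClosedNbhd S (n G₁ ↑ʳ b) (n G₁ ↑ʳ u) ∧ ⌊ (c₁ ++ c₂) (n G₁ ↑ʳ u) ≟ i ⌋
                   ≡ inClosedNbhd G₂ b u ∧ ⌊ c₂ u ≟ i ⌋
      inside u = cong₂ _∧_
        (cong₂ _∨_ (⌊⌋-⇔ (n G₁ ↑ʳ u ≟ n G₁ ↑ʳ b) (u ≟ b) (↑ʳ-injective (n G₁) u b) (cong (n G₁ ↑ʳ_)))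
                   (adj-↑ʳ-↑ʳ b u))
        (cong (λ x → ⌊ x ≟ i ⌋) (lookup-++ʳ c₁ c₂ u))

module _ (G₁ G₂ : Graph) {k} (c₁ : Fin (n G₁) → Fin k) (c₂ : Fin (n G₂) → Fin k) where

  nbhdColorCount-disjointUnion-↑ˡ : ∀ a i →
    nbhdColorCount (disjointUnion G₁ G₂) (c₁ ++ c₂) (a ↑ˡ n G₂) i ≡ nbhdColorCount G₁ c₁ a i
  nbhdColorCount-disjointUnion-↑ˡ a i =
    trans (nbhdColorCount-↑ˡ G₁ G₂ _ c₁ c₂ a i) (trans (cong (_ +_) (count-false (n G₂))) (+-identityʳ _))

  nbhdColorCount-disjointUnion-↑ʳ : ∀ b i →
    nbhdColorCount (disjointUnion G₁ G₂) (c₁ ++ c₂) (n G₁ ↑ʳ b) i ≡ nbhdColorCount G₂ c₂ b i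
  nbhdColorCount-disjointUnion-↑ʳ b i =
    trans (nbhdColorCount-↑ʳ G₁ G₂ _ c₁ c₂ b i) (cong (_+ _) (count-false (n G₁)))

  disjointUnion-isCNB : IsCNBColoring G₁ k c₁ → IsCNBColoring G₂ k c₂ →
    IsCNBColoring (disjointUnion G₁ G₂) k (c₁ ++ c₂)
  disjointUnion-isCNB cnb₁ cnb₂ = ↑-cases _
    (λ a i j → trans (nbhdColorCount-disjointUnion-↑ˡ a i)
                     (trans (cnb₁ a i j) (≡-sym (nbhdColorCount-disjointUnion-↑ˡ a j))))
    (λ b i j → trans (nbhdColorCount-disjointUnion-↑ʳ b i)
                     (trans (cnb₂ b i j) (≡-sym (nbhdColorCount-disjointUnion-↑ʳ b j))))

  nbhdColorCount-join-↑ˡ : ∀ a i →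
    nbhdColorCount (join G₁ G₂) (c₁ ++ c₂) (a ↑ˡ n G₂) i ≡ nbhdColorCount G₁ c₁ a i + colorClassSize G₂ c₂ i
  nbhdColorCount-join-↑ˡ a i =
    trans (nbhdColorCount-↑ˡ G₁ G₂ _ c₁ c₂ a i) (cong (_ +_) (≡-sym (colorClassSize≡count G₂ c₂ i)))

  nbhdColorCount-join-↑ʳ : ∀ b i →
    nbhdColorCount (join G₁ G₂) (c₁ ++ c₂) (n G₁ ↑ʳ b) i ≡ colorClassSize G₁ c₁ i + nbhdColorCount G₂ c₂ b i
  nbhdColorCount-join-↑ʳ b i =
    trans (nbhdColorCount-↑ʳ G₁ G₂ _ c₁ c₂ b i) (cong (_+ _) (≡-sym (colorClassSize≡count G₁ c₁ i)))

emptyGraph : Graph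
emptyGraph = record { n = 0 ; adj = λ () ; irrefl = λ () ; sym = λ () }

copies : ℕ → Graph → Graph
copies zero    D = emptyGraph
copies (suc M) D = disjointUnion D (copies M D)

module _ (D : Graph) {k} (d : Fin (n D) → Fin k) where

  copiesColoring : ∀ M → Fin (n (copies M D)) → Fin k
  copiesColoring zero    = λ ()
  copiesColoring (suc M) = d ++ copiesColoring M

  copies-isCNB : IsCNBColoring D k d → ∀ M → IsCNBColoring (copies M D) k (copiesColoring M)
  copies-isCNB cnb zero    = λ ()
  copies-isCNB cnb (suc M) = disjointUnion-isCNB D (copies M D) d (copiesColoring M) cnb (copies-isCNB cnb M)

  colorClassSize-copies : ∀ M i → colorClassSize (copies M D) (copiesColoring M) i ≡ M * colorClassSize D d i
  colorClassSize-copies zero    i = refl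
  colorClassSize-copies (suc M) i =
    trans (colorClassSize-connect D (copies M D) (λ _ _ → false) d (copiesColoring M) i)
          (cong (_ +_) (colorClassSize-copies M i))

-- Adding N + |G| disjoint copies of D to G widens the gap between colour i and the others by N + |G|,
-- which absorbs both N and the at most |G| vertices G contributes to colour i.
amplifyGap : ∀ (G D : Graph) {k} {c : Fin (n G) → Fin k} {d : Fin (n D) → Fin k} →
  IsCNBColoring G k c → IsCNBColoring D k d → (i : Fin k) →
  (∀ j → j ≢ i → suc (colorClassSize D d i) ≤ colorClassSize D d j) →
  ∀ N → Σ Graph λ G′ → IsInducedSubgraphOf G G′ × Unbalanced k N G′
amplifyGap G D {k} {c} {d} cnbG cnbD i gap N =
  G′ , connect-induced G (copies M D) _ ,
  c ++ dᴹ , disjointUnion-isCNB G (copies M D) c dᴹ cnbG (copies-isCNB D d cnbD M) , i , lopsided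
  where
  M = N + n G
  G′ = disjointUnion G (copies M D)
  dᴹ = copiesColoring D d M

  classSize : ∀ j → colorClassSize G′ (c ++ dᴹ) j ≡ colorClassSize G c j + M * colorClassSize D d j
  classSize j = trans (colorClassSize-connect G (copies M D) (λ _ _ → false) c dᴹ j)
                      (cong (_ +_) (colorClassSize-copies D d M j))

  lopsided : ∀ j → j ≢ i → colorClassSize G′ (c ++ dᴹ) i + N ≤ colorClassSize G′ (c ++ dᴹ) j
  lopsided j j≢i = begin
    colorClassSize G′ (c ++ dᴹ) i + N                   ≡⟨ cong (_+ N) (classSize i) ⟩
    colorClassSize G c i + M * colorClassSize D d i + N ≤⟨ +-monoˡ-≤ N (+-monoˡ-≤ _ (colorClassSize≤n G c i)) ⟩
    n G + M * colorClassSize D d i + N                  ≡⟨ rearrange N (n G) (colorClassSize D d i) ⟩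
    M * suc (colorClassSize D d i)                      ≤⟨ *-monoʳ-≤ M (gap j j≢i) ⟩
    M * colorClassSize D d j                            ≤⟨ m≤n+m _ _ ⟩
    colorClassSize G c j + M * colorClassSize D d j     ≡⟨ ≡-sym (classSize j) ⟩
    colorClassSize G′ (c ++ dᴹ) j                       ∎
    where
    open ≤-Reasoning
    open +-*-Solver
    rearrange : ∀ N g a → g + (N + g) * a + N ≡ (N + g) * suc a
    rearrange = solve 3 (λ N g a → g :+ (N :+ g) :* a :+ N := (N :+ g) :* (con 1 :+ a)) refl

clique : ℕ → Graph
clique m = record
  { n      = m
  ; adj    = λ u v → not ⌊ v ≟ u ⌋
  ; irrefl = λ u → cong not (⌊⌋-true (u ≟ u) refl)
  ; sym    = λ u v → cong not (⌊⌋-⇔ (v ≟ u) (u ≟ v) ≡-sym ≡-sym)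
  }

nbhdColorCount-clique : ∀ {m k} (c : Fin m → Fin k) v i →
  nbhdColorCount (clique m) c v i ≡ colorClassSize (clique m) c i
nbhdColorCount-clique {m} c v i = begin
  nbhdColorCount (clique m) c v i
    ≡⟨ nbhdColorCount≡count (clique m) c v i ⟩
  count (λ u → (⌊ u ≟ v ⌋ ∨ not ⌊ u ≟ v ⌋) ∧ ⌊ c u ≟ i ⌋)
    ≡⟨ count-cong (λ u → cong (_∧ ⌊ c u ≟ i ⌋) (∨-inverseʳ ⌊ u ≟ v ⌋)) ⟩
  count (λ u → ⌊ c u ≟ i ⌋)
    ≡⟨ ≡-sym (colorClassSize≡count (clique m) c i) ⟩
  colorClassSize (clique m) c i ∎
  where open ≡-Reasoning

module WindmillGadget (m : ℕ) where

  profile : ℕ → ℕ → Fin (suc m) → ℕ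
  profile a b zero    = a
  profile a b (suc _) = b

  profile-+ : ∀ a b c d i → profile a b i + profile c d i ≡ profile (a + c) (b + d) i
  profile-+ a b c d zero    = refl
  profile-+ a b c d (suc _) = refl

  profile-constant : ∀ t i → profile t t i ≡ t
  profile-constant t zero    = refl
  profile-constant t (suc _) = refl

  colorClassSize-rainbow : ∀ i → colorClassSize (clique m) suc i ≡ profile 0 1 i
  colorClassSize-rainbow zero    = trans (colorClassSize≡count (clique m) suc zero) (count-false m)
  colorClassSize-rainbow (suc j) = begin
    colorClassSize (clique m) suc (suc j)  ≡⟨ colorClassSize≡count (clique m) suc (suc j) ⟩
    count (λ u → ⌊ suc u ≟ suc j ⌋)        ≡⟨ count-cong (λ u → ⌊⌋-⇔ (suc u ≟ suc j) (u ≟ j) suc-injective (cong suc)) ⟩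
    count (λ u → ⌊ u ≟ j ⌋)                ≡⟨ count-singleton j ⟩
    1                                      ∎
    where open ≡-Reasoning

  centre : Graph
  centre = clique 1

  centreColoring : Fin 1 → Fin (suc m)
  centreColoring _ = zero

  colorClassSize-centre : ∀ i → colorClassSize centre centreColoring i ≡ profile 1 0 i
  colorClassSize-centre zero    = refl
  colorClassSize-centre (suc _) = refl

  blades : Graph
  blades = disjointUnion (clique m) (clique m)

  bladesColoring : Fin (m + m) → Fin (suc m)
  bladesColoring = suc ++ suc

  colorClassSize-blades : ∀ i → colorClassSize blades bladesColoring i ≡ profile 0 2 i
  colorClassSize-blades i =
    trans (colorClassSize-connect (clique m) (clique m) (λ _ _ → false) suc suc i)
    (trans (cong₂ _+_ (colorClassSize-rainbow i) (colorClassSize-rainbow i)) (profile-+ 0 1 0 1 i))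

  nbhdColorCount-blades : ∀ w i → nbhdColorCount blades bladesColoring w i ≡ profile 0 1 i
  nbhdColorCount-blades = ↑-cases _
    (λ a i → trans (nbhdColorCount-disjointUnion-↑ˡ (clique m) (clique m) suc suc a i)
                   (trans (nbhdColorCount-clique suc a i) (colorClassSize-rainbow i)))
    (λ b i → trans (nbhdColorCount-disjointUnion-↑ʳ (clique m) (clique m) suc suc b i)
                   (trans (nbhdColorCount-clique suc b i) (colorClassSize-rainbow i)))

  windmill : Graph
  windmill = join centre blades

  windmillColoring : Fin (n windmill) → Fin (suc m)
  windmillColoring = centreColoring ++ bladesColoring

  colorClassSize-windmill : ∀ i → colorClassSize windmill windmillColoring i ≡ profile 1 2 i
  colorClassSize-windmill i =
    trans (colorClassSize-connect centre blades (λ _ _ → true) centreColoring bladesColoring i)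
    (trans (cong₂ _+_ (colorClassSize-centre i) (colorClassSize-blades i)) (profile-+ 1 0 0 2 i))

  nbhdColorCount-windmill-centre : ∀ i → nbhdColorCount windmill windmillColoring zero i ≡ profile 1 2 i
  nbhdColorCount-windmill-centre i = begin
    nbhdColorCount windmill windmillColoring zero i
      ≡⟨ nbhdColorCount-join-↑ˡ centre blades centreColoring bladesColoring zero i ⟩
    nbhdColorCount centre centreColoring zero i + colorClassSize blades bladesColoring i
      ≡⟨ cong₂ _+_ (trans (nbhdColorCount-clique centreColoring zero i) (colorClassSize-centre i))
                   (colorClassSize-blades i) ⟩
    profile 1 0 i + profile 0 2 i
      ≡⟨ profile-+ 1 0 0 2 i ⟩
    profile 1 2 i ∎
    where open ≡-Reasoning

  nbhdColorCount-windmill-blade : ∀ w i → nbhdColorCount windmill windmillColoring (suc w) i ≡ profile 1 1 i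
  nbhdColorCount-windmill-blade w i = begin
    nbhdColorCount windmill windmillColoring (suc w) i
      ≡⟨ nbhdColorCount-join-↑ʳ centre blades centreColoring bladesColoring w i ⟩
    colorClassSize centre centreColoring i + nbhdColorCount blades bladesColoring w i
      ≡⟨ cong₂ _+_ (colorClassSize-centre i) (nbhdColorCount-blades w i) ⟩
    profile 1 0 i + profile 0 1 i
      ≡⟨ profile-+ 1 0 0 1 i ⟩
    profile 1 1 i ∎
    where open ≡-Reasoning

  centreLink : Fin (n windmill) → Fin (n windmill) → Bool
  centreLink zero    zero    = true
  centreLink zero    (suc _) = false
  centreLink (suc _) _       = false

  linkedWindmills : Graph
  linkedWindmills = connect windmill windmill centreLink

  linkedWindmillsColoring : Fin (n linkedWindmills) → Fin (suc m)
  linkedWindmillsColoring = windmillColoring ++ windmillColoring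

  count-centreLink : ∀ i → count (λ b → centreLink zero b ∧ ⌊ windmillColoring b ≟ i ⌋) ≡ profile 1 0 i
  count-centreLink zero    = cong suc (count-false (m + m))
  count-centreLink (suc _) = count-false (m + m)

  linkedWindmills-isCNB : IsCNBColoring linkedWindmills (suc m) linkedWindmillsColoring
  linkedWindmills-isCNB = ↑-cases {n windmill} {n windmill} _ left right
    where
    uniform : ∀ v t → (∀ i → nbhdColorCount linkedWindmills linkedWindmillsColoring v i ≡ profile t t i) →
      ∀ i j → nbhdColorCount linkedWindmills linkedWindmillsColoring v i
            ≡ nbhdColorCount linkedWindmills linkedWindmillsColoring v j
    uniform v t counts i j =
      trans (counts i) (trans (profile-constant t i) (≡-sym (trans (counts j) (profile-constant t j))))

    left : ∀ a i j → nbhdColorCount linkedWindmills linkedWindmillsColoring (a ↑ˡ n windmill) i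
                   ≡ nbhdColorCount linkedWindmills linkedWindmillsColoring (a ↑ˡ n windmill) j
    left zero = uniform (zero ↑ˡ n windmill) 2 λ i →
      trans (nbhdColorCount-↑ˡ windmill windmill centreLink windmillColoring windmillColoring zero i)
            (trans (cong₂ _+_ (nbhdColorCount-windmill-centre i) (count-centreLink i)) (profile-+ 1 2 1 0 i))
    left (suc w) = uniform (suc w ↑ˡ n windmill) 1 λ i →
      trans (nbhdColorCount-↑ˡ windmill windmill centreLink windmillColoring windmillColoring (suc w) i)
            (trans (cong₂ _+_ (nbhdColorCount-windmill-blade w i) (count-false (n windmill))) (+-identityʳ _))

    right : ∀ b i j → nbhdColorCount linkedWindmills linkedWindmillsColoring (n windmill ↑ʳ b) i
                    ≡ nbhdColorCount linkedWindmills linkedWindmillsColoring (n windmill ↑ʳ b) j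
    right zero = uniform (n windmill ↑ʳ zero) 2 λ i →
      trans (nbhdColorCount-↑ʳ windmill windmill centreLink windmillColoring windmillColoring zero i)
            (trans (cong₂ _+_ (count-centreLink i) (nbhdColorCount-windmill-centre i)) (profile-+ 1 0 1 2 i))
    right (suc w) = uniform (n windmill ↑ʳ suc w) 1 λ i →
      trans (nbhdColorCount-↑ʳ windmill windmill centreLink windmillColoring windmillColoring (suc w) i)
            (cong₂ _+_ (count-false (n windmill)) (nbhdColorCount-windmill-blade w i))

  colorClassSize-linkedWindmills : ∀ i → colorClassSize linkedWindmills linkedWindmillsColoring i ≡ profile 2 4 i
  colorClassSize-linkedWindmills i =
    trans (colorClassSize-connect windmill windmill centreLink windmillColoring windmillColoring i)
          (trans (cong₂ _+_ (colorClassSize-windmill i) (colorClassSize-windmill i)) (profile-+ 1 2 1 2 i))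

  linkedWindmills-gap : ∀ j → j ≢ zero →
    suc (colorClassSize linkedWindmills linkedWindmillsColoring zero) ≤ colorClassSize linkedWindmills linkedWindmillsColoring j
  linkedWindmills-gap zero    j≢0 = ⊥-elim (j≢0 refl)
  linkedWindmills-gap (suc j) _
    rewrite colorClassSize-linkedWindmills zero | colorClassSize-linkedWindmills (suc j) = n≤1+n 3

corollary2p14 : (k : ℕ) → 2 ≤ k →
    ((N : ℕ) → Σ Graph (Unbalanced k N)) ×
    ((G : Graph) → HasCNBColoring G k → (N : ℕ) →
      Σ Graph λ G' → IsInducedSubgraphOf G G' × Unbalanced k N G')
corollary2p14 zero    ()
corollary2p14 (suc m) _  = unbalanced , unbalancedSupergraph
  where
  open WindmillGadget m

  unbalancedSupergraph : (G : Graph) → HasCNBColoring G (suc m) → (N : ℕ) →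
    Σ Graph λ G′ → IsInducedSubgraphOf G G′ × Unbalanced (suc m) N G′
  unbalancedSupergraph G (c , cnb) = amplifyGap G linkedWindmills cnb linkedWindmills-isCNB zero linkedWindmills-gap

  unbalanced : (N : ℕ) → Σ Graph (Unbalanced (suc m) N)
  unbalanced N with unbalancedSupergraph emptyGraph ((λ ()) , (λ ())) N
  ... | G′ , _ , lopsided = G′ , lopsided
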